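{- Let $IP$ be a mixed-integer linear program with $m$ constraints and $\mathtt{cert}$ a VIPR certificate with constraints $C_1,\dots,C_d$, with notation as in the context. Suppose $m+1\le k\le d$ with $\mathtt{reason}(C_k)\in\{\mathtt{lin},\mathtt{rnd}\}$, that $\phi_{PRV}(k)=\mathtt{true}$, and that all previous derived constraints $C_{m+1},\dots,C_{k-1}$ are valid. Then $\mathtt{A}(C_k)=\bigcup_{i\in\mathtt{nz}(\mathtt{data}(C_k))}\mathtt{A}(C_i)$ if and only if $\phi_{ASM}(k)=\mathtt{true}$.
   Context: $IP$ has variables $x\in\mathbb{R}^n$, integer index set $I$, objective $c$, sense $\mathtt{min}$ or $\mathtt{max}$ and constraints $C_1,\dots,C_m$. A constraint $C$ has coefficients $a$, rhs $b$, sign $s(C)\in\{ -1,0,1\}$ ($\le,=,\ge$). A VIPR certificate contains $RTP$, a finite $SOL\subseteq\mathbb{R}^n$, and derived constraints $C_{m+1},\dots,C_d$, each with reason in $\{\mathtt{asm},\mathtt{lin},\mathtt{rnd},\mathtt{uns},\mathtt{sol}\}$, data, and assumption set $\mathtt{A}(C_k)\subseteq S=\{i\in\{m+1,\dots,d\}:\mathtt{reason}(C_i)=\mathtt{asm}\}$; $\mathtt{A}(C_i)=\emptyset$ for $i\le m$. For $\mathtt{lin}/\mathtt{rnd}$, data is $\lambda\in\mathbb{R}^d$ with support $\mathtt{nz}(\mathtt{data}(C_k))$; for $\mathtt{uns}$, data is $(i_1,l_1,i_2,l_2)\in[d]^4$. Domination: $(a,b,s)$ is an absurdity if $a=0$ and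 ($s=0,b\ne0$) or ($s=1,b>0$) or ($s=-1,b<0$); it dominates $(a',b',s')$ if absurd, or $a=a'$ and [$s'=0\Rightarrow s=0,b=b'$], [$s'=1\Rightarrow s\in\{0,1\},b\ge b'$], [$s'=-1\Rightarrow s\in\{0,-1\},b\le b'$]. The combination $\sum_{i\in N}\lambda_iC_i$ has coefficients $\sum\lambda_ia_i$, rhs $\sum\lambda_ib_i$, sign $0$ if all $\lambda_is(C_i)=0$, else $1$ if all $\ge0$, else $-1$ if all $\le0$, else undefined (dominates nothing). Roundable: sign $\pm1$, integer coefficients on $I$, zero off $I$; rounding replaces $b$ by $\lceil b\rceil$ or $\lfloor b\rfloor$ for sign $1$ or $-1$. Split disjunction $C_i,C_j$: same coefficient vector, integer on $I$, zero off $I$, integer rhs's, opposite nonzero signs, and one is $a\cdot x\le\delta$, the other $a\cdot x\ge\delta+1$. Validity of derived $C_k$: ($\mathtt{asm}$) $\mathtt{A}(C_k)=\{k\}$; ($\mathtt{lin}$) $\mathtt{nz}(\lambda)\subseteq[k-1]$, $\mathtt{A}(C_k)=\bigcup_{i\in\mathtt{nz}(\lambda)}\mathtt{A}(C_i)$, combination dominates $C_k$; ($\mathtt{rnd}$) same, combination roundable and its rounding dominates $C_k$; ($\mathtt{uns}$) $i_1,l_1,i_2,l_2<k$, $C_{i_1},C_{i_2}$ dominate $C_k$, $C_{l_1},C_{l_2}$ split disjunction, $\mathtt{A}(C_k)=(\mathtt{A}(C_{i_1})\setminus\{l_1\})\cup(\mathtt{A}(C_{i_2})\setminus\{l_2\})$;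 ($\mathtt{sol}$) $\mathtt{A}(C_k)=\emptyset$ and for some $sol\in SOL$, $c\cdot x\le c\cdot sol$ (min) or $c\cdot x\ge c\cdot sol$ (max) dominates $C_k$. Predicates: $A_k^j$ is the truth value of $j\in\mathtt{A}(C_k)$; $S_{<k}=\{j\in S:j<k\}$, $S_{>k}=\{j\in S:j>k\}$. $\phi_{PRV}(k)=\bigwedge_{j\in\mathtt{nz}(\mathtt{data}(C_k))}(j<k)$. For $\mathtt{reason}(C_k)\in\{\mathtt{lin},\mathtt{rnd}\}$, $\phi_{ASM}(k)=\bigwedge_{j\in S_{>k}}\neg A_k^j\wedge\bigwedge_{j\in S_{<k}}\big(A_k^j=\bigvee_{i\in\mathtt{nz}(\mathtt{data}(C_k)),\ j\le i<k}A_i^j\big)$. -}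

module Defs where

open import Data.Nat as ℕ using (ℕ; zero; suc)
open import Data.Integer as ℤ using (ℤ)
open import Data.Rational as ℚ using (ℚ; 0ℚ; 1ℚ; _+_; _*_; -_; _≤_; _<_; floor; ceiling; ↧ₙ_)
open import Data.Fin as Fin using (Fin; _↑ʳ_; splitAt)
import Data.Fin.Properties as FinP
open import Data.Bool using (Bool; true; false; _∧_; _∨_; not; if_then_else_)
open import Data.Sum using (_⊎_; inj₁; inj₂; [_,_]′)
open import Data.Product using (Σ; ∃; _×_; _,_)
open import Data.List using (List)
open import Data.List.Membership.Propositional using (_∈_)
open import Data.Maybe using (Maybe)
open import Relation.Nullary using (¬_; does)
open import Relation.Binary.PropositionalEquality using (_≡_; _≢_)

∑ : ∀ {n} → (Fin n → ℚ) → ℚ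
∑ {zero}  f = 0ℚ
∑ {suc n} f = f Fin.zero + ∑ (λ i → f (Fin.suc i))

anyFin : ∀ {n} → (Fin n → Bool) → Bool
anyFin {zero}  f = false
anyFin {suc n} f = f Fin.zero ∨ anyFin (λ i → f (Fin.suc i))

data Sign : Set where
  le eq ge : Sign

signℚ : Sign → ℚ
signℚ le = - 1ℚ
signℚ eq = 0ℚ
signℚ ge = 1ℚ

record Constraint (n : ℕ) : Set where
  constructor ⟨_,_,_⟩
  field
    coef : Fin n → ℚ
    rhs  : ℚ
    sign : Sign
open Constraint public

Absurd : ∀ {n} → Constraint n → Set
Absurd C = (∀ j → coef C j ≡ 0ℚ) ×
  ((sign C ≡ eq × rhs C ≢ 0ℚ) ⊎ (sign C ≡ ge × 0ℚ < rhs C) ⊎ (sign C ≡ le × rhs C < 0ℚ))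

SignDom : Sign → ℚ → Sign → ℚ → Set
SignDom s b eq b' = s ≡ eq × b ≡ b'
SignDom s b ge b' = (s ≡ eq ⊎ s ≡ ge) × b' ≤ b
SignDom s b le b' = (s ≡ eq ⊎ s ≡ le) × b ≤ b'

Dominates : ∀ {n} → Constraint n → Constraint n → Set
Dominates C C' = Absurd C ⊎
  ((∀ j → coef C j ≡ coef C' j) × SignDom (sign C) (rhs C) (sign C') (rhs C'))

data Sense : Set where
  min max : Sense

record IP (n m : ℕ) : Set where
  field
    I      : Fin n → Bool
    obj    : Fin n → ℚ
    sense  : Sense
    cons   : Fin m → Constraint n
open IP public

dot : ∀ {n} → (Fin n → ℚ) → (Fin n → ℚ) → ℚ
dot a x = ∑ (λ j → a j * x j)

IsIntℚ : ℚ → Set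
IsIntℚ q = ↧ₙ q ≡ 1

fromℤ : ℤ → ℚ
fromℤ z = z ℚ./ 1

IntegralOnI : ∀ {n} → (Fin n → Bool) → (Fin n → ℚ) → Set
IntegralOnI I a = ∀ j → (I j ≡ true → IsIntℚ (a j)) × (I j ≡ false → a j ≡ 0ℚ)

-- Linear combinations  ∑ λ_i C_i  (over all i; terms with λ_i = 0 vanish)

module _ {n d : ℕ} (C : Fin d → Constraint n) (λ' : Fin d → ℚ) where

  combCoef : Fin n → ℚ
  combCoef j = ∑ (λ i → λ' i * coef (C i) j)

  combRhs : ℚ
  combRhs = ∑ (λ i → λ' i * rhs (C i))

  private
    t : Fin d → ℚ
    t i = λ' i * signℚ (sign (C i))

  -- CombSign s : the sign of the combination is (defined and equal to) s
  CombSign : Sign → Set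
  CombSign eq = ∀ i → t i ≡ 0ℚ
  CombSign ge = (∀ i → 0ℚ ≤ t i) × ¬ (∀ i → t i ≡ 0ℚ)
  CombSign le = (∀ i → t i ≤ 0ℚ) × ¬ (∀ i → 0ℚ ≤ t i)

  comb : Sign → Constraint n
  comb s = ⟨ combCoef , combRhs , s ⟩

  CombDominates : Constraint n → Set
  CombDominates C' = Σ Sign λ s → CombSign s × Dominates (comb s) C'

  roundRhs : Sign → ℚ → ℚ
  roundRhs ge b = fromℤ (ceiling b)
  roundRhs le b = fromℤ (floor b)
  roundRhs eq b = b

  RoundDominates : (Fin n → Bool) → Constraint n → Set
  RoundDominates I C' = Σ Sign λ s → CombSign s × (s ≡ ge ⊎ s ≡ le) ×
    IntegralOnI I combCoef × Dominates ⟨ combCoef , roundRhs s combRhs , s ⟩ C'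

NZ : ∀ {d} → (Fin d → ℚ) → Fin d → Set
NZ λ' i = λ' i ≢ 0ℚ

nzᵇ : ∀ {d} → (Fin d → ℚ) → Fin d → Bool
nzᵇ λ' i = not (does (λ' i ℚ.≟ 0ℚ))

SplitDisj : ∀ {n} → (Fin n → Bool) → Constraint n → Constraint n → Set
SplitDisj I Ci Cj = (∀ j → coef Ci j ≡ coef Cj j) × IntegralOnI I (coef Ci) ×
  IsIntℚ (rhs Ci) × IsIntℚ (rhs Cj) ×
  ((sign Ci ≡ le × sign Cj ≡ ge × rhs Cj ≡ rhs Ci + 1ℚ) ⊎
   (sign Ci ≡ ge × sign Cj ≡ le × rhs Ci ≡ rhs Cj + 1ℚ))

data RTP : Set where
  infeasible : RTP
  range      : Maybe ℚ → Maybe ℚ → RTP   -- lower / upper bound (nothing = ∓∞)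

data Reason (d : ℕ) : Set where
  asm : Reason d
  lin : (Fin d → ℚ) → Reason d
  rnd : (Fin d → ℚ) → Reason d
  uns : Fin d → Fin d → Fin d → Fin d → Reason d
  sol : Reason d

-- Constraint indices are Fin d with d = m + e (0-based: index i stands for C_{i+1});
-- indices m ↑ʳ k' (k' : Fin e) are the derived constraints C_{m+1} … C_d.
record Derived (n d : ℕ) : Set where
  field
    constraint : Constraint n
    reason     : Reason d
    assm       : Fin d → Bool
open Derived public

record Cert {n m : ℕ} (ip : IP n m) : Set where
  field
    rtp     : RTP
    SOL     : List (Fin n → ℚ)
    e       : ℕ
    derived : Fin e → Derived n (m ℕ.+ e)
  d : ℕ
  d = m ℕ.+ e
  C : Fin d → Constraint n
  C i = [ cons ip , (λ k → constraint (derived k)) ]′ (splitAt m i)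
  A : Fin d → Fin d → Bool
  A i = [ (λ _ _ → false) , (λ k → assm (derived k)) ]′ (splitAt m i)
  InS : Fin d → Set
  InS j = Σ (Fin e) λ j' → j ≡ m ↑ʳ j' × reason (derived j') ≡ asm
  field
    A⊆S : ∀ k j → A k j ≡ true → InS j
open Cert public

module _ {n m : ℕ} {ip : IP n m} (cert : Cert ip) where
  private
    dd = d cert
    CC = C cert
    AA = A cert

  Valid : Fin (e cert) → Set
  Valid k' with reason (derived cert k')
  ... | asm = ∀ j → AA k j ≡ (does (j FinP.≟ k))
    where k = m ↑ʳ k'
  ... | lin λ' = (∀ i → NZ λ' i → i Fin.< k) ×
                 (∀ j → AA k j ≡ anyFin (λ i → nzᵇ λ' i ∧ AA i j)) ×
                 CombDominates CC λ' (CC k)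
    where k = m ↑ʳ k'
  ... | rnd λ' = (∀ i → NZ λ' i → i Fin.< k) ×
                 (∀ j → AA k j ≡ anyFin (λ i → nzᵇ λ' i ∧ AA i j)) ×
                 RoundDominates CC λ' (I ip) (CC k)
    where k = m ↑ʳ k'
  ... | uns i₁ l₁ i₂ l₂ =
                 (i₁ Fin.< k × l₁ Fin.< k × i₂ Fin.< k × l₂ Fin.< k) ×
                 Dominates (CC i₁) (CC k) × Dominates (CC i₂) (CC k) ×
                 SplitDisj (I ip) (CC l₁) (CC l₂) ×
                 (∀ j → AA k j ≡ ((AA i₁ j ∧ not (does (j FinP.≟ l₁)))
                                 ∨ (AA i₂ j ∧ not (does (j FinP.≟ l₂)))))
    where k = m ↑ʳ k'
  ... | sol = (∀ j → AA k j ≡ false) ×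
              Σ (Fin n → ℚ) λ s → s ∈ SOL cert × Dominates (objBound s) (CC k)
    where
      k = m ↑ʳ k'
      objBound : (Fin n → ℚ) → Constraint n
      objBound s with sense ip
      ... | min = ⟨ obj ip , dot (obj ip) s , le ⟩
      ... | max = ⟨ obj ip , dot (obj ip) s , ge ⟩

  φPRV : Fin dd → (Fin dd → ℚ) → Set
  φPRV k λ' = ∀ j → NZ λ' j → j Fin.< k

  φASM : Fin dd → (Fin dd → ℚ) → Set
  φASM k λ' =
    (∀ j → InS cert j → k Fin.< j → AA k j ≡ false) ×
    (∀ j → InS cert j → j Fin.< k →
       AA k j ≡ anyFin (λ i → nzᵇ λ' i ∧ does (j Fin.≤? i) ∧ does (i Fin.<? k) ∧ AA i j))

{-# OPTIONS --safe #-}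
-- Validity of the earlier derived constraints gives, by well-founded induction, that every
-- C_i with i < k only depends on assumptions j ≤ i. As nz(λ) lies below k, the union of the
-- A(C_i), i ∈ nz(λ), thus consists of assumptions j < k and coincides with the restricted
-- union of φ_ASM. Since C_k is not itself an assumption, A(C_k) ⊆ S ∖ {k}, so comparing
-- A(C_k) with the union separately on j < k and on j > k is exactly φ_ASM.
module Submission where

open import Defs
open import Data.Nat using (ℕ)
open import Data.Rational using (ℚ)
open import Data.Fin using (Fin; _↑ʳ_; _<_)
open import Data.Bool using (_∧_)
open import Data.Sum using (_⊎_)
open import Function.Bundles using (_⇔_)
open import Relation.Binary.PropositionalEquality using (_≡_)

import Data.Nat as ℕ
import Data.Nat.Properties as ℕₚ
import Data.Fin as Fin
import Data.Rational as ℚ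
open import Data.Rational using (0ℚ)
open import Data.Bool using (Bool; true; false; _∨_)
open import Data.Bool.Properties using (∧-conicalˡ; ∧-conicalʳ; ∧-zeroʳ; not-injective; ¬-not)
open import Data.Fin using (_≤_; _↑ˡ_; splitAt; _≤?_; _<?_)
open import Data.Fin.Induction using (<-wellFounded)
open import Data.Fin.Properties
  using (toℕ-↑ʳ; ↑ʳ-injective; splitAt-↑ˡ; splitAt⁻¹-↑ˡ; splitAt⁻¹-↑ʳ; <-cmp; ≤-reflexive)
open import Data.Product using (∃; _×_; _,_)
open import Data.Sum using (inj₁; inj₂)
open import Function using (_∘_)
open import Function.Bundles using (mk⇔)
open import Induction.WellFounded using (module All)
open import Level using (0ℓ)
open import Relation.Binary.Definitions using (tri<; tri≈; tri>)
open import Relation.Binary.PropositionalEquality using (refl; sym; trans; subst; subst₂; cong₂)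
open import Relation.Nullary using (¬_; Dec; yes; no; does; contradiction)
open import Relation.Nullary.Decidable using (dec-true)

≡true⇔⇒≡ : ∀ {x y : Bool} → (x ≡ true → y ≡ true) → (y ≡ true → x ≡ true) → x ≡ y
≡true⇔⇒≡ {false} {false} _ _ = refl
≡true⇔⇒≡ {false} {true}  _ y⇒x = y⇒x refl
≡true⇔⇒≡ {true}        x⇒y _ = sym (x⇒y refl)

∨≡true⇒ : ∀ x y → x ∨ y ≡ true → x ≡ true ⊎ y ≡ true
∨≡true⇒ true  _ _ = inj₁ refl
∨≡true⇒ false _ h = inj₂ h

anyFin-cong : ∀ {n} {f g : Fin n → Bool} → (∀ i → f i ≡ g i) → anyFin f ≡ anyFin g
anyFin-cong {ℕ.zero}  f≗g = refl
anyFin-cong {ℕ.suc n} f≗g = cong₂ _∨_ (f≗g Fin.zero) (anyFin-cong (f≗g ∘ Fin.suc))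

anyFin≡true⇒∃ : ∀ {n} (f : Fin n → Bool) → anyFin f ≡ true → ∃ λ i → f i ≡ true
anyFin≡true⇒∃ {ℕ.suc n} f h with f Fin.zero in f₀≡true
... | true  = Fin.zero , f₀≡true
... | false with i , fᵢ≡true ← anyFin≡true⇒∃ (f ∘ Fin.suc) h = Fin.suc i , fᵢ≡true

↑ʳ-cancel-< : ∀ m {n} (i j : Fin n) → m ↑ʳ i < m ↑ʳ j → i < j
↑ʳ-cancel-< m i j = ℕₚ.+-cancelˡ-< m _ _ ∘ subst₂ ℕ._<_ (toℕ-↑ʳ m i) (toℕ-↑ʳ m j)

does≡true⇒ : ∀ {P : Set} (p? : Dec P) → does p? ≡ true → P
does≡true⇒ (yes p) _ = p

does≡false⇒¬ : ∀ {P : Set} (p? : Dec P) → does p? ≡ false → ¬ P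
does≡false⇒¬ (no ¬p) _ = ¬p

nzᵇ≡true⇒NZ : ∀ {d} (λ' : Fin d → ℚ) i → nzᵇ λ' i ≡ true → NZ λ' i
nzᵇ≡true⇒NZ λ' i = does≡false⇒¬ (λ' i ℚ.≟ 0ℚ) ∘ not-injective

data ↑ˡ⊎↑ʳ (m n : ℕ) : Fin (m ℕ.+ n) → Set where
  left  : ∀ i → ↑ˡ⊎↑ʳ m n (i ↑ˡ n)
  right : ∀ i → ↑ˡ⊎↑ʳ m n (m ↑ʳ i)

↑ˡ-or-↑ʳ : ∀ m {n} (i : Fin (m ℕ.+ n)) → ↑ˡ⊎↑ʳ m n i
↑ˡ-or-↑ʳ m i with splitAt m i in splitAt≡
... | inj₁ i₀ = subst (↑ˡ⊎↑ʳ m _) (splitAt⁻¹-↑ˡ splitAt≡) (left i₀)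
... | inj₂ i' = subst (↑ˡ⊎↑ʳ m _) (splitAt⁻¹-↑ʳ splitAt≡) (right i')

module _ {n m : ℕ} {ip : IP n m} (cert : Cert ip) where

  AssumptionsUpTo : Fin (d cert) → Set
  AssumptionsUpTo i = ∀ j → A cert i j ≡ true → j ≤ i

  A-↑ˡ≡false : ∀ i j → A cert (i ↑ˡ e cert) j ≡ false
  A-↑ˡ≡false i j rewrite splitAt-↑ˡ m i (e cert) = refl

  inherited-< : ∀ {i : Fin (d cert)} → (∀ {l} → l < i → AssumptionsUpTo l) →
                ∀ {l j : Fin (d cert)} → l < i → A cert l j ≡ true → j < i
  inherited-< upTo l<i j∈Aₗ = ℕₚ.≤-<-trans (upTo l<i _ j∈Aₗ) l<i

  ⋃A : (Fin (d cert) → ℚ) → Fin (d cert) → Bool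
  ⋃A λ' j = anyFin (λ i → nzᵇ λ' i ∧ A cert i j)

  ⋃A≡true⇒ : ∀ λ' {j} → ⋃A λ' j ≡ true → ∃ λ i → NZ λ' i × A cert i j ≡ true
  ⋃A≡true⇒ λ' h with i , p ← anyFin≡true⇒∃ _ h =
    i , nzᵇ≡true⇒NZ λ' i (∧-conicalˡ _ _ p) , ∧-conicalʳ _ _ p

  ⋃A⊆S : ∀ λ' {j} → ⋃A λ' j ≡ true → InS cert j
  ⋃A⊆S λ' h with i , _ , j∈Aᵢ ← ⋃A≡true⇒ λ' h = A⊆S cert i _ j∈Aᵢ

  ⋃A-< : ∀ λ' {i j} → φPRV cert i λ' → (∀ {l} → l < i → AssumptionsUpTo l) →
         ⋃A λ' j ≡ true → j < i
  ⋃A-< λ' prv upTo h with l , l∈nz , j∈Aₗ ← ⋃A≡true⇒ λ' h =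
    inherited-< upTo (prv l l∈nz) j∈Aₗ

  valid⇒assumptionsUpTo : ∀ i' → Valid cert i' → (∀ {l} → l < m ↑ʳ i' → AssumptionsUpTo l) →
                          AssumptionsUpTo (m ↑ʳ i')
  valid⇒assumptionsUpTo i' valid upTo j j∈A with reason (derived cert i') | valid
  ... | asm | A≡[i] = ≤-reflexive (does≡true⇒ (j Fin.≟ m ↑ʳ i') (trans (sym (A≡[i] j)) j∈A))
  ... | lin λ' | prv , A≡⋃A , _ = ℕₚ.<⇒≤ (⋃A-< λ' prv upTo (trans (sym (A≡⋃A j)) j∈A))
  ... | rnd λ' | prv , A≡⋃A , _ = ℕₚ.<⇒≤ (⋃A-< λ' prv upTo (trans (sym (A≡⋃A j)) j∈A))
  ... | uns i₁ _ i₂ _ | (i₁<i , _ , i₂<i , _) , _ , _ , _ , A≡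
    with ∨≡true⇒ _ _ (trans (sym (A≡ j)) j∈A)
  ...   | inj₁ p = ℕₚ.<⇒≤ (inherited-< upTo i₁<i (∧-conicalˡ _ _ p))
  ...   | inj₂ p = ℕₚ.<⇒≤ (inherited-< upTo i₂<i (∧-conicalˡ _ _ p))
  valid⇒assumptionsUpTo i' valid upTo j j∈A | sol | A≡∅ , _ =
    contradiction (trans (sym j∈A) (A≡∅ j)) λ ()

  assumptionsUpTo-< : ∀ k' → (∀ i' → i' Fin.< k' → Valid cert i') →
                      ∀ {i} → i < m ↑ʳ k' → AssumptionsUpTo i
  assumptionsUpTo-< k' valid {i} =
    All.wfRec <-wellFounded 0ℓ (λ i → i < m ↑ʳ k' → AssumptionsUpTo i) step i
    where
    step : ∀ i → (∀ {l} → l < i → l < m ↑ʳ k' → AssumptionsUpTo l) →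
           i < m ↑ʳ k' → AssumptionsUpTo i
    step i ih i<k with ↑ˡ-or-↑ʳ m i
    ... | left i₀ = λ j j∈A → contradiction (trans (sym j∈A) (A-↑ˡ≡false i₀ j)) λ ()
    ... | right i' =
      valid⇒assumptionsUpTo i' (valid i' (↑ʳ-cancel-< m i' k' i<k))
        (λ l<i → ih l<i (ℕₚ.<-trans l<i i<k))

  ⋃A≡⋃A-between : ∀ {λ' k} → φPRV cert k λ' → (∀ {l} → l < k → AssumptionsUpTo l) → ∀ j →
    ⋃A λ' j ≡ anyFin (λ i → nzᵇ λ' i ∧ does (j ≤? i) ∧ does (i <? k) ∧ A cert i j)
  ⋃A≡⋃A-between {λ'} {k} prv upTo j = anyFin-cong term
    where
    term : ∀ i → nzᵇ λ' i ∧ A cert i j ≡ nzᵇ λ' i ∧ does (j ≤? i) ∧ does (i <? k) ∧ A cert i j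
    term i with nzᵇ λ' i in nz | A cert i j in j∈Aᵢ
    ... | false | _ = refl
    ... | true | false rewrite ∧-zeroʳ (does (i <? k)) | ∧-zeroʳ (does (j ≤? i)) = refl
    ... | true | true with i<k ← prv i (nzᵇ≡true⇒NZ λ' i nz)
      rewrite dec-true (j ≤? i) (upTo i<k j j∈Aᵢ) | dec-true (i <? k) i<k = refl

  A≡⋃A⇔φASM : ∀ {λ' k} → ¬ InS cert k → φPRV cert k λ' → (∀ {l} → l < k → AssumptionsUpTo l) →
              (∀ j → A cert k j ≡ ⋃A λ' j) ⇔ φASM cert k λ'
  A≡⋃A⇔φASM {λ'} {k} k∉S prv upTo = mk⇔ to from
    where
    to : (∀ j → A cert k j ≡ ⋃A λ' j) → φASM cert k λ'
    to A≡⋃A = (λ j _ k<j → trans (A≡⋃A j) (¬-not λ j∈⋃A → ℕₚ.<-asym k<j (⋃A-< λ' prv upTo j∈⋃A)))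
            , (λ j _ _ → trans (A≡⋃A j) (⋃A≡⋃A-between prv upTo j))
    from : φASM cert k λ' → ∀ j → A cert k j ≡ ⋃A λ' j
    from (above , below) j = ≡true⇔⇒≡ A⇒⋃A ⋃A⇒A
      where
      A⇒⋃A : A cert k j ≡ true → ⋃A λ' j ≡ true
      A⇒⋃A j∈A with <-cmp j k | A⊆S cert k j j∈A
      ... | tri< j<k _ _ | j∈S =
        trans (⋃A≡⋃A-between prv upTo j) (trans (sym (below j j∈S j<k)) j∈A)
      ... | tri≈ _ j≡k _ | j∈S = contradiction (subst (InS cert) j≡k j∈S) k∉S
      ... | tri> _ _ k<j | j∈S = contradiction (trans (sym j∈A) (above j j∈S k<j)) λ ()
      ⋃A⇒A : ⋃A λ' j ≡ true → A cert k j ≡ true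
      ⋃A⇒A j∈⋃A = trans (below j (⋃A⊆S λ' j∈⋃A) (⋃A-< λ' prv upTo j∈⋃A))
                        (trans (sym (⋃A≡⋃A-between prv upTo j)) j∈⋃A)

  lin⊎rnd⇒∉S : ∀ {k' λ'} → reason (derived cert k') ≡ lin λ' ⊎ reason (derived cert k') ≡ rnd λ' →
               ¬ InS cert (m ↑ʳ k')
  lin⊎rnd⇒∉S (inj₁ r) (_ , k≡j , j-asm) with refl ← ↑ʳ-injective m _ _ k≡j
    with () ← trans (sym r) j-asm
  lin⊎rnd⇒∉S (inj₂ r) (_ , k≡j , j-asm) with refl ← ↑ʳ-injective m _ _ k≡j
    with () ← trans (sym r) j-asm

lemma5 : {n m : ℕ} (ip : IP n m) (cert : Cert ip) (k' : Fin (e cert))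
         (λ' : Fin (d cert) → ℚ) →
         (reason (derived cert k') ≡ lin λ' ⊎ reason (derived cert k') ≡ rnd λ') →
         φPRV cert (m ↑ʳ k') λ' →
         (∀ i' → i' < k' → Valid cert i') →
         ((∀ j → A cert (m ↑ʳ k') j ≡ anyFin (λ i → nzᵇ λ' i ∧ A cert i j))
           ⇔ φASM cert (m ↑ʳ k') λ')
lemma5 ip cert k' λ' linOrRnd prv valid =
  A≡⋃A⇔φASM cert (lin⊎rnd⇒∉S cert linOrRnd) prv (assumptionsUpTo-< cert k' valid)
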